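{- Every locally finite variety of bounded lattices that is meet semidistributive, or join semidistributive, or semidistributive, is passive structurally complete.
   Context: Bounded lattices are lattices with constants $0,1$ for bottom and top. A lattice is meet semidistributive if it satisfies $x\wedge y\approx x\wedge z\Rightarrow x\wedge y\approx x\wedge(y\vee z)$, join semidistributive if it satisfies $x\vee y\approx x\vee z\Rightarrow x\vee y\approx x\vee(y\wedge z)$, and semidistributive if both; a variety is (meet/join) semidistributive if all its members are. For a quasivariety $\mathcal Q$ with free algebra $\mathbf F_{\mathcal Q}(\omega)$: a substitution (homomorphism from terms to $\mathbf F_{\mathcal Q}(\omega)$) unifies $\Sigma$ if it identifies both sides of each equation; a quasiequation $\Sigma\Rightarrow\delta$ is admissible if every substitution unifying $\Sigma$ unifies $\delta$, passive if no substitution unifies $\Sigma$; $\mathcal Q$ is passive structurally complete if every passive admissible quasiequation is valid in $\mathcal Q$. -}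

module Defs where

open import Level using (0ℓ)
open import Data.Nat using (ℕ)
open import Data.Fin using (Fin)
open import Data.List using (List)
open import Data.List.Relation.Unary.All using (All)
open import Data.List.Relation.Unary.Any using (Any)
open import Data.Product using (_×_; _,_; ∃; ∃-syntax; Σ-syntax)
open import Data.Sum using (_⊎_)
open import Relation.Nullary using (¬_)
open import Algebra.Lattice.Bundles using (Lattice)

record BoundedLattice : Set₁ where
  field
    lattice : Lattice 0ℓ 0ℓ
  open Lattice lattice public
  field
    ⊥ : Carrier
    ⊤ : Carrier
    ⊥-bottom : ∀ x → (x ∨ ⊥) ≈ x
    ⊤-top    : ∀ x → (x ∧ ⊤) ≈ x

data Term (X : Set) : Set where
  var  : X → Term X
  _∧ₜ_ : Term X → Term X → Term X
  _∨ₜ_ : Term X → Term X → Term X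
  0ₜ   : Term X
  1ₜ   : Term X

eval : {X : Set} (A : BoundedLattice) → (X → BoundedLattice.Carrier A) → Term X → BoundedLattice.Carrier A
eval A ρ (var x)  = ρ x
eval A ρ (s ∧ₜ t) = BoundedLattice._∧_ A (eval A ρ s) (eval A ρ t)
eval A ρ (s ∨ₜ t) = BoundedLattice._∨_ A (eval A ρ s) (eval A ρ t)
eval A ρ 0ₜ       = BoundedLattice.⊥ A
eval A ρ 1ₜ       = BoundedLattice.⊤ A

_[_] : {X Y : Set} → Term X → (X → Term Y) → Term Y
var x    [ σ ] = σ x
(s ∧ₜ t) [ σ ] = (s [ σ ]) ∧ₜ (t [ σ ])
(s ∨ₜ t) [ σ ] = (s [ σ ]) ∨ₜ (t [ σ ])
0ₜ       [ σ ] = 0ₜ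
1ₜ       [ σ ] = 1ₜ

Equation : Set
Equation = Term ℕ × Term ℕ

-- Varieties of bounded lattices, presented (Birkhoff) by a set of
-- identities E over ω variables: the variety is Mod(E).

Variety : Set₁
Variety = Equation → Set

_⊨_≈_ : {X : Set} → BoundedLattice → Term X → Term X → Set
_⊨_≈_ {X} A s t = ∀ (ρ : X → BoundedLattice.Carrier A) →
  BoundedLattice._≈_ A (eval A ρ s) (eval A ρ t)

_∈V_ : BoundedLattice → Variety → Set
A ∈V V = ∀ (e : Equation) → V e → (let (s , t) = e in A ⊨ s ≈ t)

_⊫_≈_ : {X : Set} → Variety → Term X → Term X → Set₁
V ⊫ s ≈ t = ∀ (A : BoundedLattice) → A ∈V V → A ⊨ s ≈ t

-- Locally finite: every finitely generated free algebra F_V(n) is finite,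
-- i.e. the terms in n variables fall into finitely many V-classes.
LocallyFinite : Variety → Set₁
LocallyFinite V = ∀ (n : ℕ) → ∃[ ts ] (∀ (t : Term (Fin n)) → Any (λ u → V ⊫ t ≈ u) ts)

MeetSD-alg : BoundedLattice → Set
MeetSD-alg A = ∀ x y z → (x ∧ y) ≈ (x ∧ z) → (x ∧ y) ≈ (x ∧ (y ∨ z))
  where open BoundedLattice A

JoinSD-alg : BoundedLattice → Set
JoinSD-alg A = ∀ x y z → (x ∨ y) ≈ (x ∨ z) → (x ∨ y) ≈ (x ∨ (y ∧ z))
  where open BoundedLattice A

MeetSemidistributive : Variety → Set₁
MeetSemidistributive V = ∀ A → A ∈V V → MeetSD-alg A

JoinSemidistributive : Variety → Set₁
JoinSemidistributive V = ∀ A → A ∈V V → JoinSD-alg A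

Semidistributive : Variety → Set₁
Semidistributive V = MeetSemidistributive V × JoinSemidistributive V

record Quasiequation : Set where
  constructor _⇒_
  field
    premises   : List Equation
    conclusion : Equation

-- σ : Term ℕ → F_V(ω) (given by images of variables, as terms) unifies e
Unifies : Variety → (ℕ → Term ℕ) → Equation → Set₁
Unifies V σ (s , t) = V ⊫ (s [ σ ]) ≈ (t [ σ ])

UnifiesAll : Variety → (ℕ → Term ℕ) → List Equation → Set₁
UnifiesAll V σ Σ = All (Unifies V σ) Σ

Admissible : Variety → Quasiequation → Set₁
Admissible V (Σ ⇒ δ) = ∀ (σ : ℕ → Term ℕ) → UnifiesAll V σ Σ → Unifies V σ δ

Passive : Variety → Quasiequation → Set₁
Passive V (Σ ⇒ δ) = ¬ (Σ[ σ ∈ (ℕ → Term ℕ) ] UnifiesAll V σ Σ)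

HoldsIn : BoundedLattice → Quasiequation → Set
HoldsIn A (Σ ⇒ (s , t)) = ∀ (ρ : ℕ → BoundedLattice.Carrier A) →
  All (λ e → let (u , v) = e in BoundedLattice._≈_ A (eval A ρ u) (eval A ρ v)) Σ →
  BoundedLattice._≈_ A (eval A ρ s) (eval A ρ t)

Valid : Variety → Quasiequation → Set₁
Valid V q = ∀ A → A ∈V V → HoldsIn A q

PassiveStructurallyComplete : Variety → Set₁
PassiveStructurallyComplete V = ∀ (q : Quasiequation) → Passive V q → Admissible V q → Valid V q

{-# OPTIONS --safe #-}
-- A passive quasiequation Σ ⇒ δ has premises Σ without a solution in the
-- two-element lattice 𝟚: a solution β would give the unifier v ↦ (β v ? 1 : 0).
-- Let ρ solve Σ in a meet semidistributive bounded lattice A. Meeting the values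
-- ρ v one at a time, and skipping those that would make the meet ⊥, yields
-- a ≠ ⊥ that for each variable v of Σ is below ρ v or disjoint from it. Then
-- x ↦ [a ≤ x] is a homomorphism to 𝟚 on the values of terms over these variables
-- (joins are preserved since a ∧ x = a ∧ y = ⊥ forces a ∧ (x ∨ y) = ⊥), so it
-- solves Σ in 𝟚. Hence A is trivial and satisfies every quasiequation; the join
-- semidistributive case is dual.
module Submission where

open import Defs
open import Data.Sum using (_⊎_; inj₁; inj₂; [_,_])
open import Data.Nat using (ℕ; _≟_)
open import Data.Bool using (Bool; true; false; not; if_then_else_)
  renaming (_∧_ to _∧ᵇ_; _∨_ to _∨ᵇ_)
open import Data.Bool.Properties
  using (∨-∧-lattice; ∨-∧-booleanAlgebra; ∨-identityʳ; ∧-identityʳ; not-involutive; not-injective)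
open import Data.List using (List; []; _∷_; _++_; map; concatMap)
open import Data.List.Relation.Unary.All using (All; []; _∷_) renaming (map to All-map)
open import Data.List.Relation.Unary.All.Properties using (++⁻ˡ; ++⁻ʳ; map⁺; map⁻)
open import Data.Product using (_,_; proj₁; proj₂; ∃)
open import Data.Empty using (⊥-elim)
open import Function using (_∘_)
open import Relation.Nullary using (¬_; yes; no)
open import Relation.Binary.PropositionalEquality as ≡ using (_≡_)
open import Relation.Binary.Bundles using (Poset)
import Relation.Binary.Lattice as Order
import Relation.Binary.Reasoning.Setoid as SetoidReasoning
import Algebra.Lattice.Properties.Lattice as LatticeProperties
open import Algebra.Lattice.Properties.BooleanAlgebra ∨-∧-booleanAlgebra using (deMorgan₁; deMorgan₂)

𝟚 : BoundedLattice
𝟚 = record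
  { lattice  = ∨-∧-lattice
  ; ⊥        = false
  ; ⊤        = true
  ; ⊥-bottom = ∨-identityʳ
  ; ⊤-top    = ∧-identityʳ
  }

Trivial : BoundedLattice → Set
Trivial A = ⊥ ≈ ⊤
  where open BoundedLattice A

Solves : (A : BoundedLattice) → (ℕ → BoundedLattice.Carrier A) → List Equation → Set
Solves A ρ = All (λ e → eval A ρ (proj₁ e) ≈ eval A ρ (proj₂ e))
  where open BoundedLattice A

Solvable : BoundedLattice → List Equation → Set
Solvable A Σ = ∃ λ ρ → Solves A ρ Σ

vars : {X : Set} → Term X → List X
vars (var x)  = x ∷ []
vars (u ∧ₜ w) = vars u ++ vars w
vars (u ∨ₜ w) = vars u ++ vars w
vars 0ₜ       = []
vars 1ₜ       = []

varsₑ : Equation → List ℕ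
varsₑ e = vars (proj₁ e) ++ vars (proj₂ e)

module BoundedLatticeProperties (A : BoundedLattice) where
  open BoundedLattice A
  open LatticeProperties lattice using (poset; ∨-∧-orderTheoreticLattice)
  open Poset poset public using (_≤_) renaming (trans to ≤-trans)
  open Order.Lattice ∨-∧-orderTheoreticLattice public using (x≤x∨y; y≤x∨y; x∧y≤x; x∧y≤y; ∧-greatest)
  open SetoidReasoning setoid

  ∨-identityˡ : ∀ x → (⊥ ∨ x) ≈ x
  ∨-identityˡ x = trans (∨-comm ⊥ x) (⊥-bottom x)

  ∧-identityˡ : ∀ x → (⊤ ∧ x) ≈ x
  ∧-identityˡ x = trans (∧-comm ⊤ x) (⊤-top x)

  ∧-zeroˡ : ∀ x → (⊥ ∧ x) ≈ ⊥
  ∧-zeroˡ x = trans (∧-congˡ (sym (∨-identityˡ x))) (∧-absorbs-∨ ⊥ x)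

  ∧-zeroʳ : ∀ x → (x ∧ ⊥) ≈ ⊥
  ∧-zeroʳ x = trans (∧-comm x ⊥) (∧-zeroˡ x)

  ∨-zeroˡ : ∀ x → (⊤ ∨ x) ≈ ⊤
  ∨-zeroˡ x = trans (∨-congˡ (sym (∧-identityˡ x))) (∨-absorbs-∧ ⊤ x)

  x≤⊤ : ∀ x → x ≤ ⊤
  x≤⊤ x = sym (⊤-top x)

  trivial⇒≈ : Trivial A → ∀ x y → x ≈ y
  trivial⇒≈ ⊥≈⊤ x y = trans (≈⊥ x) (sym (≈⊥ y))
    where
    ≈⊥ : ∀ z → z ≈ ⊥
    ≈⊥ z = trans (x≤⊤ z) (trans (∧-congˡ (sym ⊥≈⊤)) (∧-zeroʳ z))

  Disjoint : Carrier → Carrier → Set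
  Disjoint a x = (a ∧ x) ≈ ⊥

  Disjoint-sym : ∀ {a x} → Disjoint a x → Disjoint x a
  Disjoint-sym {a} {x} d = trans (∧-comm x a) d

  Disjoint-antitoneʳ : ∀ {a x y} → y ≤ x → Disjoint a x → Disjoint a y
  Disjoint-antitoneʳ {a} {x} {y} y≤x d = begin
    a ∧ y        ≈⟨ ∧-congˡ y≤x ⟩
    a ∧ (y ∧ x)  ≈⟨ ∧-congˡ (∧-comm y x) ⟩
    a ∧ (x ∧ y)  ≈⟨ ∧-assoc a x y ⟨
    (a ∧ x) ∧ y  ≈⟨ ∧-congʳ d ⟩
    ⊥ ∧ y        ≈⟨ ∧-zeroˡ y ⟩
    ⊥            ∎

  ≤∧Disjoint⇒≈⊥ : ∀ {a x} → a ≤ x → Disjoint a x → a ≈ ⊥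
  ≤∧Disjoint⇒≈⊥ = trans

  ⟦_⟧ : Bool → Carrier
  ⟦ true ⟧  = ⊤
  ⟦ false ⟧ = ⊥

  ⟦⟧-∧-homo : ∀ b c → ⟦ b ∧ᵇ c ⟧ ≈ (⟦ b ⟧ ∧ ⟦ c ⟧)
  ⟦⟧-∧-homo true  true  = sym (⊤-top ⊤)
  ⟦⟧-∧-homo true  false = sym (∧-zeroʳ ⊤)
  ⟦⟧-∧-homo false c     = sym (∧-zeroˡ ⟦ c ⟧)

  ⟦⟧-∨-homo : ∀ b c → ⟦ b ∨ᵇ c ⟧ ≈ (⟦ b ⟧ ∨ ⟦ c ⟧)
  ⟦⟧-∨-homo true  c     = sym (∨-zeroˡ ⟦ c ⟧)
  ⟦⟧-∨-homo false true  = sym (∨-identityˡ ⊤)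
  ⟦⟧-∨-homo false false = sym (⊥-bottom ⊥)

constSubst : (ℕ → Bool) → ℕ → Term ℕ
constSubst β v = if β v then 1ₜ else 0ₜ

module _ (B : BoundedLattice) where
  open BoundedLattice B
  open BoundedLatticeProperties B

  eval-constSubst : ∀ ρ β u → eval B ρ (u [ constSubst β ]) ≈ ⟦ eval 𝟚 β u ⟧
  eval-constSubst ρ β (var v) with β v
  ... | true  = refl
  ... | false = refl
  eval-constSubst ρ β (u ∧ₜ w) =
    trans (∧-cong (eval-constSubst ρ β u) (eval-constSubst ρ β w)) (sym (⟦⟧-∧-homo (eval 𝟚 β u) (eval 𝟚 β w)))
  eval-constSubst ρ β (u ∨ₜ w) =
    trans (∨-cong (eval-constSubst ρ β u) (eval-constSubst ρ β w)) (sym (⟦⟧-∨-homo (eval 𝟚 β u) (eval 𝟚 β w)))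
  eval-constSubst ρ β 0ₜ = refl
  eval-constSubst ρ β 1ₜ = refl

𝟚-solution⇒unifier : ∀ V {β Σ} → Solves 𝟚 β Σ → UnifiesAll V (constSubst β) Σ
𝟚-solution⇒unifier V {β} = All-map λ {e} l≡r B _ ρ →
  let open BoundedLattice B in
  trans (eval-constSubst B ρ β (proj₁ e))
    (trans (reflexive (≡.cong (BoundedLatticeProperties.⟦_⟧ B) l≡r))
      (sym (eval-constSubst B ρ β (proj₂ e))))

_[_↦_] : (ℕ → Bool) → ℕ → Bool → ℕ → Bool
(β [ v ↦ b ]) w with w ≟ v
... | yes _ = b
... | no _  = β w

module Separation (A : BoundedLattice) where
  open BoundedLattice A
  open BoundedLatticeProperties A

  Bit : Carrier → Bool → Carrier → Set
  Bit a true  x = a ≤ x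
  Bit a false x = Disjoint a x

  Bit-∧ : ∀ {a x y} b c → Bit a b x → Bit a c y → Bit a (b ∧ᵇ c) (x ∧ y)
  Bit-∧ true  true  a≤x a≤y = ∧-greatest a≤x a≤y
  Bit-∧ true  false _   dy  = Disjoint-antitoneʳ (x∧y≤y _ _) dy
  Bit-∧ false c     dx  _   = Disjoint-antitoneʳ (x∧y≤x _ _) dx

  Bit-shrink : ∀ {a x} b z → Bit a b x → Bit (a ∧ z) b x
  Bit-shrink true  z a≤x = ≤-trans (x∧y≤x _ z) a≤x
  Bit-shrink false z d   = Disjoint-sym (Disjoint-antitoneʳ (x∧y≤x _ z) (Disjoint-sym d))

  Bit-≈ : ∀ {a x y} b c → Bit a b x → Bit a c y → x ≈ y → b ≡ c ⊎ a ≈ ⊥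
  Bit-≈ true  true  _   _   _   = inj₁ ≡.refl
  Bit-≈ false false _   _   _   = inj₁ ≡.refl
  Bit-≈ true  false a≤x dy x≈y = inj₂ (≤∧Disjoint⇒≈⊥ a≤x (trans (∧-congˡ x≈y) dy))
  Bit-≈ false true  dx a≤y x≈y = inj₂ (≤∧Disjoint⇒≈⊥ a≤y (trans (∧-congˡ (sym x≈y)) dx))

  Bits : Carrier → (ℕ → Bool) → (ℕ → Carrier) → List ℕ → Set
  Bits a β ρ = All (λ v → Bit a (β v) (ρ v))

  Bits-update : ∀ {a β ρ v b} vs → Bit a b (ρ v) → Bits a β ρ vs → Bits a (β [ v ↦ b ]) ρ (v ∷ vs)
  Bits-update {a} {β} {ρ} {v} {b} vs bit bits = new ∷ All-map (λ {w} → old w) bits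
    where
    new : Bit a ((β [ v ↦ b ]) v) (ρ v)
    new with v ≟ v
    ... | yes _   = bit
    ... | no v≢v  = ⊥-elim (v≢v ≡.refl)

    old : ∀ w → Bit a (β w) (ρ w) → Bit a ((β [ v ↦ b ]) w) (ρ w)
    old w bitʷ with w ≟ v
    ... | yes ≡.refl = bit
    ... | no _       = bitʷ

  Bits-shrink : ∀ {a β ρ} z vs → Bits a β ρ vs → Bits (a ∧ z) β ρ vs
  Bits-shrink {β = β} z vs = All-map (λ {w} → Bit-shrink (β w) z)

  -- Whether a ∧ ρ v is ⊥ cannot be decided, so the case split happens inside a
  -- continuation whose answer is Trivial A: the branch a ∧ ρ v ≈ ⊥ is only
  -- entered when the continuation has refuted the candidate a ∧ ρ v.
  separatingElement : ∀ ρ vs →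
    (∀ a β → (a ≈ ⊥ → Trivial A) → Bits a β ρ vs → Trivial A) → Trivial A
  separatingElement ρ [] k = k ⊤ (λ _ → false) sym []
  separatingElement ρ (v ∷ vs) k = separatingElement ρ vs λ a β a≉⊥ bits →
    k (a ∧ ρ v) (β [ v ↦ true ])
      (λ disjoint → k a (β [ v ↦ false ]) a≉⊥ (Bits-update vs disjoint bits))
      (Bits-update vs (x∧y≤y a (ρ v)) (Bits-shrink {β = β} (ρ v) vs bits))

module MeetSemidistributiveLattice (A : BoundedLattice) (meetSD : MeetSD-alg A) where
  open BoundedLattice A
  open BoundedLatticeProperties A
  open Separation A

  Bit-∨ : ∀ {a x y} b c → Bit a b x → Bit a c y → Bit a (b ∨ᵇ c) (x ∨ y)
  Bit-∨ true  c     a≤x _   = ≤-trans a≤x (x≤x∨y _ _)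
  Bit-∨ false true  _   a≤y = ≤-trans a≤y (y≤x∨y _ _)
  Bit-∨ {a} {x} {y} false false dx dy = trans (sym (meetSD a x y (trans dx (sym dy)))) dx

  module _ {a : Carrier} {β : ℕ → Bool} {ρ : ℕ → Carrier} where

    Bit-eval : ∀ u → Bits a β ρ (vars u) → Bit a (eval 𝟚 β u) (eval A ρ u)
    Bit-eval (var v) (bit ∷ []) = bit
    Bit-eval (u ∧ₜ w) bits = Bit-∧ (eval 𝟚 β u) (eval 𝟚 β w)
      (Bit-eval u (++⁻ˡ (vars u) bits)) (Bit-eval w (++⁻ʳ (vars u) bits))
    Bit-eval (u ∨ₜ w) bits = Bit-∨ (eval 𝟚 β u) (eval 𝟚 β w)
      (Bit-eval u (++⁻ˡ (vars u) bits)) (Bit-eval w (++⁻ʳ (vars u) bits))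
    Bit-eval 0ₜ [] = ∧-zeroʳ a
    Bit-eval 1ₜ [] = x≤⊤ a

    Bits-solves : ∀ Σ → Bits a β ρ (concatMap varsₑ Σ) → Solves A ρ Σ → Solves 𝟚 β Σ ⊎ a ≈ ⊥
    Bits-solves [] _ [] = inj₁ []
    Bits-solves ((l , r) ∷ Σ) bits (l≈r ∷ sol)
      with Bit-≈ (eval 𝟚 β l) (eval 𝟚 β r) (Bit-eval l bitsˡ) (Bit-eval r bitsʳ) l≈r
         | Bits-solves Σ (++⁻ʳ (varsₑ (l , r)) bits) sol
      where
      bitsₑ = ++⁻ˡ (varsₑ (l , r)) bits
      bitsˡ = ++⁻ˡ (vars l) bitsₑ
      bitsʳ = ++⁻ʳ (vars l) bitsₑ
    ... | inj₁ l≡r | inj₁ solβ = inj₁ (l≡r ∷ solβ)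
    ... | inj₂ a≈⊥ | _         = inj₂ a≈⊥
    ... | inj₁ _   | inj₂ a≈⊥  = inj₂ a≈⊥

  meetSD-solvable⇒trivial : ∀ {ρ Σ} → Solves A ρ Σ → ¬ Solvable 𝟚 Σ → Trivial A
  meetSD-solvable⇒trivial {ρ} {Σ} sol no𝟚 =
    separatingElement ρ (concatMap varsₑ Σ) λ a β a≉⊥ bits →
      [ (λ solβ → ⊥-elim (no𝟚 (β , solβ))) , a≉⊥ ] (Bits-solves Σ bits sol)

dual : BoundedLattice → BoundedLattice
dual A = record
  { lattice  = LatticeProperties.∧-∨-lattice lattice
  ; ⊥        = ⊤
  ; ⊤        = ⊥
  ; ⊥-bottom = ⊤-top
  ; ⊤-top    = ⊥-bottom
  }
  where open BoundedLattice A

dualᵗ : {X : Set} → Term X → Term X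
dualᵗ (var x)  = var x
dualᵗ (u ∧ₜ w) = dualᵗ u ∨ₜ dualᵗ w
dualᵗ (u ∨ₜ w) = dualᵗ u ∧ₜ dualᵗ w
dualᵗ 0ₜ       = 1ₜ
dualᵗ 1ₜ       = 0ₜ

dualₑ : Equation → Equation
dualₑ e = dualᵗ (proj₁ e) , dualᵗ (proj₂ e)

eval-dual : ∀ A {X} (ρ : X → BoundedLattice.Carrier A) u → eval (dual A) ρ (dualᵗ u) ≡ eval A ρ u
eval-dual A ρ (var x)  = ≡.refl
eval-dual A ρ (u ∧ₜ w) = ≡.cong₂ (BoundedLattice._∧_ A) (eval-dual A ρ u) (eval-dual A ρ w)
eval-dual A ρ (u ∨ₜ w) = ≡.cong₂ (BoundedLattice._∨_ A) (eval-dual A ρ u) (eval-dual A ρ w)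
eval-dual A ρ 0ₜ       = ≡.refl
eval-dual A ρ 1ₜ       = ≡.refl

eval-𝟚-dual : ∀ {X} (β : X → Bool) u → eval 𝟚 β (dualᵗ u) ≡ not (eval 𝟚 (not ∘ β) u)
eval-𝟚-dual β (var x)  = ≡.sym (not-involutive (β x))
eval-𝟚-dual β (u ∧ₜ w) =
  ≡.trans (≡.cong₂ _∨ᵇ_ (eval-𝟚-dual β u) (eval-𝟚-dual β w)) (≡.sym (deMorgan₁ (eval 𝟚 (not ∘ β) u) (eval 𝟚 (not ∘ β) w)))
eval-𝟚-dual β (u ∨ₜ w) =
  ≡.trans (≡.cong₂ _∧ᵇ_ (eval-𝟚-dual β u) (eval-𝟚-dual β w)) (≡.sym (deMorgan₂ (eval 𝟚 (not ∘ β) u) (eval 𝟚 (not ∘ β) w)))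
eval-𝟚-dual β 0ₜ       = ≡.refl
eval-𝟚-dual β 1ₜ       = ≡.refl

Solves-dual : ∀ A {ρ Σ} → Solves A ρ Σ → Solves (dual A) ρ (map dualₑ Σ)
Solves-dual A {ρ} sol = map⁺ (All-map (λ {e} →
  ≡.subst₂ (BoundedLattice._≈_ A) (≡.sym (eval-dual A ρ (proj₁ e))) (≡.sym (eval-dual A ρ (proj₂ e)))) sol)

Solves-𝟚-undual : ∀ {β Σ} → Solves 𝟚 β (map dualₑ Σ) → Solves 𝟚 (not ∘ β) Σ
Solves-𝟚-undual {β} sol = All-map (λ {e} l≡r → not-injective
  (≡.trans (≡.sym (eval-𝟚-dual β (proj₁ e))) (≡.trans l≡r (eval-𝟚-dual β (proj₂ e))))) (map⁻ sol)

-- Join semidistributivity of A is, definitionally, meet semidistributivity of its dual.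
joinSD-solvable⇒trivial : ∀ A → JoinSD-alg A → ∀ {ρ Σ} → Solves A ρ Σ → ¬ Solvable 𝟚 Σ → Trivial A
joinSD-solvable⇒trivial A joinSD sol no𝟚 = BoundedLattice.sym A
  (MeetSemidistributiveLattice.meetSD-solvable⇒trivial (dual A) joinSD (Solves-dual A sol)
    λ (β , solβ) → no𝟚 (not ∘ β , Solves-𝟚-undual solβ))

corollary5p12 : (V : Variety) → LocallyFinite V →
    (MeetSemidistributive V ⊎ JoinSemidistributive V ⊎ Semidistributive V) →
    PassiveStructurallyComplete V
corollary5p12 V _ sd (Σ ⇒ (s , t)) passive _ A A∈V ρ sol =
  BoundedLatticeProperties.trivial⇒≈ A (A-trivial sd) (eval A ρ s) (eval A ρ t)
  where
  no𝟚 : ¬ Solvable 𝟚 Σ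
  no𝟚 (β , solβ) = passive (constSubst β , 𝟚-solution⇒unifier V solβ)

  meetCase : MeetSD-alg A → Trivial A
  meetCase meetSD = MeetSemidistributiveLattice.meetSD-solvable⇒trivial A meetSD sol no𝟚

  A-trivial : MeetSemidistributive V ⊎ JoinSemidistributive V ⊎ Semidistributive V → Trivial A
  A-trivial (inj₁ meetSD)             = meetCase (meetSD A A∈V)
  A-trivial (inj₂ (inj₁ joinSD))      = joinSD-solvable⇒trivial A (joinSD A A∈V) sol no𝟚
  A-trivial (inj₂ (inj₂ (meetSD , _))) = meetCase (meetSD A A∈V)
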